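{- Let $q$ be an odd prime power, let $n\ge 4$ and $r\ge 2$ with $rn$ an integer, and let $G$ be a decodable graph representation (over $GF(q)$) with $n$ vertices and $rn$ edges whose minimum incidence degree is $\delta_I(G)=2r$. Then $u^G_{2r}\ge n$.
   Context: Graph representation of a coding scheme on packets $p_1,\dots,p_n\in GF(q)^\ell$: vertices $p_1,\dots,p_n$, an edge joining $p_j,p_k$ per encoding $p_j+p_k$ ($j\ne k$), a loop at $p_j$ per encoding $p_j$ (multigraph, edges labelled distinctly). A spanning subgraph is decodable if the encodings of its edges determine $p_1,\dots,p_n$ uniquely, otherwise undecodable. The incidence degree of $v$ is the number of edges incident with $v$ (a loop counts once); $\delta_I(G)$ is its minimum over vertices. For $G=(V,E)$ with $m$ edges and integer $x$, $c^G_x$ counts $x$-subsets $X\subseteq E$ with $(V,E\setminus X)$ decodable and $u^G_x=\binom{m}{x}-c^G_x$. -}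

module Defs where

open import Level using (0ℓ)
open import Data.Nat using (ℕ; zero; suc; _^_; _≤_)
import Data.Nat as ℕ
open import Data.Nat.Primality using (Prime)

open import Data.Bool using (Bool; true; false; if_then_else_; _∨_)
open import Data.Fin using (Fin; _≟_)
open import Data.Fin.Subset using (Subset; _∈_; ∁; ∣_∣)
open import Data.Vec using (Vec; []; _∷_; lookup)
open import Data.Product using (Σ; ∃; _×_; _,_)
open import Relation.Nullary using (¬_; Dec; yes; no; does)
open import Relation.Binary.PropositionalEquality using (_≡_; _≢_; setoid)
open import Algebra.Bundles using (CommutativeRing)
open import Function.Bundles using (Inverse)

record IsField (F : CommutativeRing 0ℓ 0ℓ) : Set where
  open CommutativeRing F
  field
    1≉0     : ¬ (1# ≈ 0#)
    inverse : ∀ x → ¬ (x ≈ 0#) → ∃ λ y → (x * y) ≈ 1#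

OddPrimePower : ℕ → Set
OddPrimePower q = Σ ℕ λ p → Σ ℕ λ e → Prime p × (3 ≤ p) × (1 ≤ e) × (q ≡ p ^ e)

record GF (q : ℕ) : Set₁ where
  field
    ring     : CommutativeRing 0ℓ 0ℓ
    isField  : IsField ring
    finite   : Inverse (CommutativeRing.setoid ring) (setoid (Fin q))

-- Edges of a graph representation on n vertices (packets p_0 … p_{n-1}):
-- a loop at j (encoding p_j) or an edge joining j ≠ k (encoding p_j + p_k).
data Edge (n : ℕ) : Set where
  loop : Fin n → Edge n
  link : (j k : Fin n) → j ≢ k → Edge n

Graph : ℕ → ℕ → Set
Graph n m = Vec (Edge n) m

module _ {q : ℕ} (𝔽 : GF q) where
  open GF 𝔽
  open CommutativeRing ring

  encode : ∀ {n L} → Edge n → (Fin n → Fin L → Carrier) → Fin L → Carrier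
  encode (loop j)     p t = p j t
  encode (link j k _) p t = p j t + p k t

  Decodable : ∀ {n m} → Graph n m → Subset m → Set
  Decodable {n} {m} G S =
    ∀ (L : ℕ) (p p′ : Fin n → Fin L → Carrier) →
    (∀ (i : Fin m) → i ∈ S → ∀ t → encode (lookup G i) p t ≈ encode (lookup G i) p′ t) →
    ∀ j t → p j t ≈ p′ j t

full : ∀ m → Subset m
full m = ∁ (Data.Fin.Subset.⊥)

-- whether an edge is incident with vertex v (a loop counts once)
incident : ∀ {n} → Edge n → Fin n → Bool
incident (loop j)     v = does (j ≟ v)
incident (link j k _) v = does (j ≟ v) ∨ does (k ≟ v)

incDeg : ∀ {n m} → Graph n m → Fin n → ℕ
incDeg []       v = 0
incDeg (e ∷ es) v = (if incident e v then 1 else 0) ℕ.+ incDeg es v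

MinIncDeg : ∀ {n m} → Graph n m → ℕ → Set
MinIncDeg {n} G d = (∀ v → d ≤ incDeg G v) × (∃ λ (v : Fin n) → incDeg G v ≡ d)

module Submission where

-- Proof idea.  For a vertex v let star(v) be the set of edges incident with v.
--
-- Every edge is incident with at most two vertices, so the
--     incidence degrees sum to at most 2m = kn.  As every degree is at least
--     k, every degree is exactly k, i.e. |star(v)| = k for all n vertices.
--   * Deleting star(v) isolates v: the unit packet assignment e_v (1 at v,
--     0 elsewhere) and the zero assignment have equal encodings on every
--     remaining edge, so (V, E ∖ star(v)) is undecodable.
--   * If star(v) = star(w) then every edge meets v and w equally often, so
--     e_v and e_w have equal encodings on all of E; decodability of G
--     forces e_v = e_w, i.e. v = w.  Hence v ↦ star(v) is injective.

open import Defs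
open import Data.Nat using (ℕ; zero; suc; _+_; _*_; _≤_; z≤n; s≤s)
open import Data.Nat.Properties
  using (≤-refl; ≤-trans; ≤-reflexive; ≤-antisym; +-mono-≤; +-cancelʳ-≤; *-comm; *-zeroʳ; *-suc; +-0-commutativeMonoid; module ≤-Reasoning)
open import Data.Bool using (Bool; true; false; if_then_else_; _∨_; not)
open import Data.Bool.Properties using (not-injective)
open import Data.Fin using (Fin; zero; suc; _≟_; punchIn)
open import Data.Fin.Properties using (punchInᵢ≢i)
open import Data.Fin.Subset using (Subset; _∈_; ∁; ∣_∣)
open import Data.Vec using (_∷_; []; lookup; map)
open import Data.Vec.Properties using (lookup-map; []=⇒lookup)
open import Data.Product using (_×_; ∃; _,_)
open import Data.Empty using (⊥-elim)
open import Relation.Nullary using (¬_; yes; no; does)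
open import Relation.Nullary.Decidable using (dec-true; dec-false; decidable-stable)
open import Relation.Binary.PropositionalEquality using (_≡_; refl; sym; trans; cong; cong₂; module ≡-Reasoning)
open import Function.Definitions using (Injective)
open import Algebra.Bundles using (CommutativeRing)
open import Algebra.Properties.CommutativeMonoid.Sum +-0-commutativeMonoid
  using (sum; sum-remove; sum-cong-≗; ∑-distrib-+)

sum-mono-≤ : ∀ {n} {f g : Fin n → ℕ} → (∀ v → f v ≤ g v) → sum f ≤ sum g
sum-mono-≤ {zero}  f≤g = z≤n
sum-mono-≤ {suc n} f≤g = +-mono-≤ (f≤g zero) (sum-mono-≤ (λ v → f≤g (suc v)))

sum-const : ∀ n k → sum {n} (λ _ → k) ≡ n * k
sum-const zero    k = refl
sum-const (suc n) k = cong (k +_) (sum-const n k)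

-- If f ≥ k pointwise on n points but Σ f ≤ n·k, then f is constantly k:
-- one entry above k would push the sum above n·k.
tight-lower-bound : ∀ {n} k (f : Fin n → ℕ) → (∀ v → k ≤ f v) → sum f ≤ n * k → ∀ v → f v ≡ k
tight-lower-bound {suc n} k f k≤f Σf≤nk v = ≤-antisym fv≤k (k≤f v)
  where
  open ≤-Reasoning
  fv≤k : f v ≤ k
  fv≤k = +-cancelʳ-≤ (n * k) (f v) k (begin
    f v + n * k                           ≡⟨ cong (f v +_) (sym (sum-const n k)) ⟩
    f v + sum {n} (λ _ → k)               ≤⟨ +-mono-≤ ≤-refl (sum-mono-≤ (λ i → k≤f (punchIn v i))) ⟩
    f v + sum (λ i → f (punchIn v i))     ≡⟨ sym (sum-remove f) ⟩
    sum f                                 ≤⟨ Σf≤nk ⟩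
    k + n * k                             ∎)

𝟙 : Bool → ℕ
𝟙 b = if b then 1 else 0

𝟙-∨ : ∀ a b → 𝟙 (a ∨ b) ≤ 𝟙 a + 𝟙 b
𝟙-∨ true  b = s≤s z≤n
𝟙-∨ false b = ≤-refl

sum-𝟙-≟ : ∀ {n} (j : Fin n) → sum (λ v → 𝟙 (does (j ≟ v))) ≡ 1
sum-𝟙-≟ {suc n} j = begin
  sum (λ v → 𝟙 (does (j ≟ v)))                 ≡⟨ sum-remove (λ v → 𝟙 (does (j ≟ v))) ⟩
  𝟙 (does (j ≟ j)) + sum (λ i → 𝟙 (does (j ≟ punchIn j i)))
                                               ≡⟨ cong₂ _+_ (cong 𝟙 (dec-true (j ≟ j) refl)) (sum-cong-≗ off) ⟩
  1 + sum {n} (λ _ → 0)                        ≡⟨ cong suc (sum-const n 0) ⟩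
  1 + n * 0                                    ≡⟨ cong suc (*-zeroʳ n) ⟩
  1                                            ∎
  where
  open ≡-Reasoning
  off : ∀ i → 𝟙 (does (j ≟ punchIn j i)) ≡ 0
  off i = cong 𝟙 (dec-false (j ≟ punchIn j i) (λ j≡ → punchInᵢ≢i j i (sym j≡)))

edge-incidences≤2 : ∀ {n} (e : Edge n) → sum (λ v → 𝟙 (incident e v)) ≤ 2
edge-incidences≤2 (loop j)     = ≤-trans (≤-reflexive (sum-𝟙-≟ j)) (s≤s z≤n)
edge-incidences≤2 (link j k _) = begin
  sum (λ v → 𝟙 (does (j ≟ v) ∨ does (k ≟ v)))            ≤⟨ sum-mono-≤ (λ v → 𝟙-∨ (does (j ≟ v)) (does (k ≟ v))) ⟩
  sum (λ v → 𝟙 (does (j ≟ v)) + 𝟙 (does (k ≟ v)))        ≡⟨ ∑-distrib-+ (λ v → 𝟙 (does (j ≟ v))) (λ v → 𝟙 (does (k ≟ v))) ⟩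
  sum (λ v → 𝟙 (does (j ≟ v))) + sum (λ v → 𝟙 (does (k ≟ v)))
                                                          ≡⟨ cong₂ _+_ (sum-𝟙-≟ j) (sum-𝟙-≟ k) ⟩
  2                                                       ∎
  where open ≤-Reasoning

handshake : ∀ {n m} (G : Graph n m) → sum (incDeg G) ≤ 2 * m
handshake {n} []           = ≤-reflexive (trans (sum-const n 0) (*-zeroʳ n))
handshake {n} {suc m} (e ∷ G) = begin
  sum (λ v → 𝟙 (incident e v) + incDeg G v)          ≡⟨ ∑-distrib-+ (λ v → 𝟙 (incident e v)) (incDeg G) ⟩
  sum (λ v → 𝟙 (incident e v)) + sum (incDeg G)      ≤⟨ +-mono-≤ (edge-incidences≤2 e) (handshake G) ⟩
  2 + 2 * m                                          ≡⟨ sym (*-suc 2 m) ⟩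
  2 * suc m                                          ∎
  where open ≤-Reasoning

incidence-regular : ∀ {n m} k (G : Graph n m) → 2 * m ≡ k * n → (∀ v → k ≤ incDeg G v) →
                    ∀ v → incDeg G v ≡ k
incidence-regular {n} k G 2m≡kn k≤deg =
  tight-lower-bound k (incDeg G) k≤deg
    (≤-trans (handshake G) (≤-reflexive (trans 2m≡kn (*-comm k n))))

star : ∀ {n m} → Graph n m → Fin n → Subset m
star G v = map (λ e → incident e v) G

∣star∣≡incDeg : ∀ {n m} (G : Graph n m) v → ∣ star G v ∣ ≡ incDeg G v
∣star∣≡incDeg []      v = refl
∣star∣≡incDeg (e ∷ G) v with incident e v
... | true  = cong suc (∣star∣≡incDeg G v)
... | false = ∣star∣≡incDeg G v

∉star : ∀ {n m} (G : Graph n m) v i → i ∈ ∁ (star G v) → incident (lookup G i) v ≡ false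
∉star G v i i∈∁ = trans (sym (lookup-map i (λ e → incident e v) G))
  (not-injective (trans (sym (lookup-map i not (star G v))) ([]=⇒lookup i∈∁)))

star-incidence : ∀ {n m} (G : Graph n m) {v w} → star G v ≡ star G w →
                 ∀ i → incident (lookup G i) v ≡ incident (lookup G i) w
star-incidence G {v} {w} eq i = begin
  incident (lookup G i) v                    ≡⟨ lookup-map i (λ e → incident e v) G ⟨
  lookup (star G v) i                        ≡⟨ cong (λ X → lookup X i) eq ⟩
  lookup (star G w) i                        ≡⟨ lookup-map i (λ e → incident e w) G ⟩
  incident (lookup G i) w                    ∎
  where open ≡-Reasoning

module _ {q : ℕ} (𝔽 : GF q) where
  open GF 𝔽 using (ring; isField)
  open CommutativeRing ring
    using (Carrier; _≈_; 0#; 1#; setoid; +-identityˡ; +-identityʳ)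
    renaming (refl to ≈-refl)
  open IsField isField using (1≉0)

  χ : Bool → Carrier
  χ b = if b then 1# else 0#

  unit : ∀ {n} → Fin n → Fin n → Fin 1 → Carrier
  unit v j _ = χ (does (j ≟ v))

  blank : ∀ {n} → Fin n → Fin 1 → Carrier
  blank _ _ = 0#

  encode-unit : ∀ {n} (e : Edge n) v t → encode 𝔽 e (unit v) t ≈ χ (incident e v)
  encode-unit (loop j)       v t = ≈-refl
  encode-unit (link j k j≢k) v t with j ≟ v | k ≟ v
  ... | yes j≡v | yes k≡v = ⊥-elim (j≢k (trans j≡v (sym k≡v)))
  ... | yes _   | no _    = +-identityʳ 1#
  ... | no _    | yes _   = +-identityˡ 1#
  ... | no _    | no _    = +-identityˡ 0#

  encode-blank : ∀ {n} (e : Edge n) t → encode 𝔽 e blank t ≈ 0#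
  encode-blank (loop j)     t = ≈-refl
  encode-blank (link j k _) t = +-identityˡ 0#

  -- Removing the star of v leaves v isolated, hence undecodable: the unit
  -- assignment at v looks like the zero assignment on every remaining edge.
  star-removal-undecodable : ∀ {n m} (G : Graph n m) v → ¬ Decodable 𝔽 G (∁ (star G v))
  star-removal-undecodable {m = m} G v D = 1≉0 (begin
    1#              ≡⟨ cong χ (dec-true (v ≟ v) refl) ⟨
    unit v v zero   ≈⟨ D 1 (unit v) blank agree v zero ⟩
    0#              ∎)
    where
    open import Relation.Binary.Reasoning.Setoid setoid
    agree : ∀ (i : Fin m) → i ∈ ∁ (star G v) → ∀ t →
            encode 𝔽 (lookup G i) (unit v) t ≈ encode 𝔽 (lookup G i) blank t
    agree i i∉star t = begin
      encode 𝔽 (lookup G i) (unit v) t    ≈⟨ encode-unit (lookup G i) v t ⟩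
      χ (incident (lookup G i) v)         ≡⟨ cong χ (∉star G v i i∉star) ⟩
      0#                                  ≈⟨ encode-blank (lookup G i) t ⟨
      encode 𝔽 (lookup G i) blank t       ∎

  -- In a decodable graph distinct vertices have distinct stars: equal stars
  -- make the unit assignments at v and w indistinguishable.
  star-injective : ∀ {n m} (G : Graph n m) → Decodable 𝔽 G (full m) → Injective _≡_ _≡_ (star G)
  star-injective {m = m} G D {v} {w} same-star = decidable-stable (v ≟ w) (λ v≢w → 1≉0 (begin
    1#              ≡⟨ cong χ (dec-true (v ≟ v) refl) ⟨
    unit v v zero   ≈⟨ D 1 (unit v) (unit w) agree v zero ⟩
    unit w v zero   ≡⟨ cong χ (dec-false (v ≟ w) v≢w) ⟩
    0#              ∎))
    where
    open import Relation.Binary.Reasoning.Setoid setoid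
    agree : ∀ (i : Fin m) → i ∈ full m → ∀ t →
            encode 𝔽 (lookup G i) (unit v) t ≈ encode 𝔽 (lookup G i) (unit w) t
    agree i _ t = begin
      encode 𝔽 (lookup G i) (unit v) t    ≈⟨ encode-unit (lookup G i) v t ⟩
      χ (incident (lookup G i) v)         ≡⟨ cong χ (star-incidence G same-star i) ⟩
      χ (incident (lookup G i) w)         ≈⟨ encode-unit (lookup G i) w t ⟨
      encode 𝔽 (lookup G i) (unit w) t    ∎

-- Lemma 11: the n stars are pairwise distinct k-sets of edges whose removal
-- destroys decodability, so u^G_k ≥ n.
lemma11 : ∀ (q : ℕ) → OddPrimePower q → (𝔽 : GF q) →
    ∀ (n k m : ℕ) → 4 ≤ n → 4 ≤ k → 2 * m ≡ k * n →
    (G : Graph n m) → Decodable 𝔽 G (full m) → MinIncDeg G k →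
    ∃ λ (X : Fin n → Subset m) → Injective _≡_ _≡_ X ×
    (∀ i → (∣ X i ∣ ≡ k) × ¬ Decodable 𝔽 G (∁ (X i)))
lemma11 q _ 𝔽 n k m _ _ 2m≡kn G decodable (k≤deg , _) =
  star G , star-injective 𝔽 G decodable , λ v →
    trans (∣star∣≡incDeg G v) (incidence-regular k G 2m≡kn k≤deg v) ,
    star-removal-undecodable 𝔽 G v
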